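{- Let $p$ be an odd prime and let $c\in GF(p)\setminus\{0\}$ be a nonsquare if $p\equiv 1 \pmod 4$ and a nonzero square if $p\equiv 3\pmod 4$. For $k\in\{1,\dots,p-1\}$ let $O_k\subset PG(2,p)$ be the conic $x^2+ky^2+ckz^2=0$. If $O_\alpha\diamond O_\beta$ and the pair $(O_\alpha,O_\beta)$ has a $4$-sided Poncelet polygon, then $\alpha=2\beta$ in $GF(p)$.
   Context: $PG(2,p)$ is the projective plane over $GF(p)$ with homogeneous coordinates. A tangent of a conic is a line meeting it in exactly one point; a point is an exterior point of a conic $O$ if exactly two tangents of $O$ pass through it; $O\diamond O'$ means every point of $O'$ is an exterior point of $O$. An $n$-sided Poncelet polygon for $(O_\alpha,O_\beta)$ is a cyclic sequence of $n$ distinct points $B_1,\dots,B_n\in O_\beta$ such that each line $B_iB_{i+1}$ ($B_{n+1}=B_1$) is a tangent of $O_\alpha$. -}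

module Defs where

open import Data.Nat as ℕ using (ℕ; suc; NonZero)
open import Data.Nat.DivMod using (_%_; m%n<n)
open import Data.Integer using (ℤ; +_; _+_; _-_; _*_; 0ℤ)
open import Data.Integer.Divisibility using (_∣_)
open import Data.Fin using (Fin; toℕ; fromℕ<)
open import Data.Product using (Σ; ∃; _×_; _,_)
open import Data.Sum using (_⊎_)
open import Relation.Nullary using (¬_)
open import Relation.Binary.PropositionalEquality using (_≡_)

-- Arithmetic of GF(p), with elements represented by integers modulo p.
_≡[_]_ : ℤ → ℕ → ℤ → Set
a ≡[ p ] b = (+ p) ∣ (a - b)

IsSquare : ℕ → ℤ → Set
IsSquare p c = ∃ λ x → (x * x) ≡[ p ] c

-- Homogeneous coordinates of a point (or, dually, a line) of PG(2,p):
-- a triple not all of whose entries are zero in GF(p).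
record Pt (p : ℕ) : Set where
  constructor pt
  field
    x y z : ℤ
    nonzero : ¬ ((x ≡[ p ] 0ℤ) × (y ≡[ p ] 0ℤ) × (z ≡[ p ] 0ℤ))

Line : ℕ → Set
Line = Pt

_∼[_]_ : {p : ℕ} → Pt p → ℕ → Pt p → Set
P ∼[ p ] Q = ∃ λ l → ¬ (l ≡[ p ] 0ℤ) ×
  (Pt.x P ≡[ p ] (l * Pt.x Q)) × (Pt.y P ≡[ p ] (l * Pt.y Q)) × (Pt.z P ≡[ p ] (l * Pt.z Q))

Inc : {p : ℕ} → Pt p → Line p → Set
Inc {p} P L = (Pt.x L * Pt.x P + Pt.y L * Pt.y P + Pt.z L * Pt.z P) ≡[ p ] 0ℤ

Conic : (p : ℕ) → (c : ℤ) → (k : ℕ) → Pt p → Set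
Conic p c k P =
  (Pt.x P * Pt.x P + (+ k) * (Pt.y P * Pt.y P) + c * (+ k) * (Pt.z P * Pt.z P)) ≡[ p ] 0ℤ

IsTangent : {p : ℕ} → (Pt p → Set) → Line p → Set
IsTangent {p} O L = ∃ λ P → O P × Inc P L × (∀ Q → O Q → Inc Q L → Q ∼[ p ] P)

IsExterior : {p : ℕ} → (Pt p → Set) → Pt p → Set
IsExterior {p} O P = Σ (Line p) λ L₁ → Σ (Line p) λ L₂ →
  IsTangent O L₁ × Inc P L₁ × IsTangent O L₂ × Inc P L₂ × ¬ (L₁ ∼[ p ] L₂) ×
  (∀ L → IsTangent O L → Inc P L → (L ∼[ p ] L₁) ⊎ (L ∼[ p ] L₂))

_◇_ : {p : ℕ} → (Pt p → Set) → (Pt p → Set) → Set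
O ◇ O' = ∀ P → O' P → IsExterior O P

next : (n : ℕ) → .{{_ : NonZero n}} → Fin n → Fin n
next n i = fromℕ< (m%n<n (suc (toℕ i)) n)

-- An n-sided Poncelet polygon for (Oα, Oβ): n pairwise distinct points of Oβ,
-- cyclically ordered, such that each line B_i B_{i+1} is a tangent of Oα.
-- (Since B_i ≠ B_{i+1}, the line B_i B_{i+1} is the unique line through both.)
PonceletPolygon : {p : ℕ} → (n : ℕ) → .{{_ : NonZero n}} →
  (Pt p → Set) → (Pt p → Set) → Set
PonceletPolygon {p} n Oα Oβ = Σ (Fin n → Pt p) λ B →
  (∀ i j → ¬ (i ≡ j) → ¬ (B i ∼[ p ] B j)) ×
  (∀ i → Oβ (B i)) ×
  (∀ i → Σ (Line p) λ L → IsTangent Oα L × Inc (B i) L × Inc (B (next n i)) L)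

module Submission where

open import Defs
open import Data.Nat as ℕ using (ℕ; suc; _≤_; _<_; s≤s; z≤n)
open import Data.Nat.DivMod using (_%_)
open import Data.Nat.Primality using (Prime; euclidsLemma; prime⇒irreducible; prime⇒nonTrivial)
open import Data.Nat.Coprimality using (Coprime; coprime-Bézout)
open import Data.Nat.GCD using (module Bézout)
import Data.Nat.Divisibility as ℕ∣
import Data.Nat.Properties as ℕP
open import Data.Integer using (ℤ; +_; -[1+_]; _+_; _-_; _*_; -_; 0ℤ; 1ℤ; ∣_∣)
import Data.Integer.Properties as ℤP
import Data.Integer.Divisibility.Signed as ℤ∣
open import Data.Integer.Tactic.RingSolver using (solve-∀)
open import Data.Fin using (#_)
open import Data.Product using (Σ; _×_; _,_)
open import Data.Sum using (_⊎_; inj₁; inj₂; [_,_]′)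
open import Data.Empty using (⊥; ⊥-elim)
open import Relation.Nullary using (¬_; Dec; yes; no)
open import Relation.Nullary.Decidable using (_×-dec_; decidable-stable)
open import Relation.Binary.PropositionalEquality
  using (_≡_; _≢_; refl; sym; cong; subst; module ≡-Reasoning)

-- Write Φ_k for the bilinear form diag(1, k, ck) of O_k.  A chord BB' on a tangent
--     of O_α has vanishing Gram determinant for Φ_α (tangent-chord); for B, B' ∈ O_β this
--     determinant factors, giving ρ(B,B') = 0 for ρ = diag(2β - α, αβ, cαβ) (side-relation).
--   * Theorem: the four sides of the quadrilateral B₀B₁B₂B₃ give that B₁ and B₃ are both
--     ρ-orthogonal to B₀ and B₂; were ρ nondegenerate, B₁ = B₃ would follow.  So 2β = α.

module GF (p : ℕ) (prime : Prime p) where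

  -- e = 0 in GF(p).  A record, so that e can be recovered from a proof of IsZero e.
  record IsZero (e : ℤ) : Set where
    constructor vanishes
    field ≡0 : e ≡[ p ] 0ℤ
  open IsZero public

  private
    minus-zero : ∀ e → ∣ e - 0ℤ ∣ ≡ ∣ e ∣
    minus-zero e = cong ∣_∣ (ℤP.+-identityʳ e)

  fromℕ∣ : ∀ {e} → p ℕ∣.∣ ∣ e ∣ → IsZero e
  fromℕ∣ {e} d = vanishes (subst (p ℕ∣.∣_) (sym (minus-zero e)) d)

  toℕ∣ : ∀ {e} → IsZero e → p ℕ∣.∣ ∣ e ∣
  toℕ∣ {e} (vanishes d) = subst (p ℕ∣.∣_) (minus-zero e) d

  private
    toℤ∣ : ∀ {e} → IsZero e → + p ℤ∣.∣ e
    toℤ∣ {e} z = ℤ∣.∣ᵤ⇒∣ {+ p} {e} (toℕ∣ z)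

    fromℤ∣ : ∀ {e} → + p ℤ∣.∣ e → IsZero e
    fromℤ∣ {e} d = fromℕ∣ (ℤ∣.∣⇒∣ᵤ {+ p} {e} d)

  -- Vanishing elements form an ideal; together with 'by', an equation t = Σ kᵢ eᵢ
  -- of integer polynomials and eᵢ = 0 in GF(p) certify t = 0 in GF(p).
  infixr 6 _⊕_
  infixr 7 _⊛_

  _⊕_ : ∀ {a b} → IsZero a → IsZero b → IsZero (a + b)
  _⊕_ {a} {b} za zb = fromℤ∣ (ℤ∣.∣m∣n⇒∣m+n (toℤ∣ za) (toℤ∣ zb))

  _⊛_ : ∀ k {a} → IsZero a → IsZero (k * a)
  k ⊛ za = fromℤ∣ (ℤ∣.∣n⇒∣m*n k (toℤ∣ za))

  by : ∀ {t s} → t ≡ s → IsZero s → IsZero t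
  by refl z = z

  zero-0 : IsZero 0ℤ
  zero-0 = fromℤ∣ (ℤ∣.divides 0ℤ refl)

  multiple-of-p : ∀ k → IsZero (k * + p)
  multiple-of-p k = fromℤ∣ (ℤ∣.divides k refl)

  zero? : ∀ a → Dec (IsZero a)
  zero? a with p ℕ∣.∣? ∣ a ∣
  ... | yes d = yes (fromℕ∣ d)
  ... | no ¬d = no (λ z → ¬d (toℕ∣ z))

  zero-product : ∀ a b → IsZero (a * b) → IsZero a ⊎ IsZero b
  zero-product a b z with euclidsLemma ∣ a ∣ ∣ b ∣ prime (subst (p ℕ∣.∣_) (ℤP.abs-* a b) (toℕ∣ z))
  ... | inj₁ d = inj₁ (fromℕ∣ d)
  ... | inj₂ d = inj₂ (fromℕ∣ d)

  nonzero-* : ∀ {a b} → ¬ IsZero a → ¬ IsZero b → ¬ IsZero (a * b)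
  nonzero-* {a} {b} a≢0 b≢0 z with zero-product a b z
  ... | inj₁ za = a≢0 za
  ... | inj₂ zb = b≢0 zb

  cancel : ∀ {m a} → ¬ IsZero m → IsZero (m * a) → IsZero a
  cancel {m} {a} m≢0 z with zero-product m a z
  ... | inj₁ zm = ⊥-elim (m≢0 zm)
  ... | inj₂ za = za

  small-nonzero : ∀ n → 1 ≤ n → n < p → ¬ IsZero (+ n)
  small-nonzero (suc n) _ n<p z = ℕP.<⇒≱ n<p (ℕ∣.∣⇒≤ (toℕ∣ z))

  inverse : ∀ a → ¬ IsZero a → Σ ℤ λ g → IsZero (g * a - 1ℤ)
  inverse (+ n) n≢0 = natural-inverse n n≢0
    where
    coprime : ∀ n → ¬ IsZero (+ n) → Coprime n p
    coprime n n≢0 (d∣n , d∣p) with prime⇒irreducible prime d∣p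
    ... | inj₁ d≡1 = d≡1
    ... | inj₂ refl = ⊥-elim (n≢0 (fromℕ∣ d∣n))

    lift : ∀ u v w t → 1 ℕ.+ u ℕ.* v ≡ w ℕ.* t → 1ℤ + + u * + v ≡ + w * + t
    lift u v w t eq = begin
      1ℤ + + u * + v     ≡⟨ cong (λ t → 1ℤ + t) (sym (ℤP.pos-* u v)) ⟩
      1ℤ + + (u ℕ.* v)   ≡⟨ sym (ℤP.pos-+ 1 (u ℕ.* v)) ⟩
      + (1 ℕ.+ u ℕ.* v)  ≡⟨ cong +_ eq ⟩
      + (w ℕ.* t)        ≡⟨ ℤP.pos-* w t ⟩
      + w * + t          ∎
      where open ≡-Reasoning

    positive : ∀ x n y p → 1ℤ + y * p ≡ x * n → x * n - 1ℤ ≡ y * p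
    positive x n y p eq = begin
      x * n - 1ℤ       ≡⟨ cong (_- 1ℤ) (sym eq) ⟩
      1ℤ + y * p - 1ℤ  ≡⟨ cancel-one (y * p) ⟩
      y * p            ∎
      where
      open ≡-Reasoning
      cancel-one : ∀ m → 1ℤ + m - 1ℤ ≡ m
      cancel-one = solve-∀

    negative : ∀ x n y p → 1ℤ + x * n ≡ y * p → (- x) * n - 1ℤ ≡ (- y) * p
    negative x n y p eq = begin
      (- x) * n - 1ℤ   ≡⟨ negate-sum x n ⟩
      - (1ℤ + x * n)   ≡⟨ cong -_ eq ⟩
      - (y * p)        ≡⟨ negate-product y p ⟩
      (- y) * p        ∎
      where
      open ≡-Reasoning
      negate-sum : ∀ x n → (- x) * n - 1ℤ ≡ - (1ℤ + x * n)
      negate-sum = solve-∀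
      negate-product : ∀ y p → - (y * p) ≡ (- y) * p
      negate-product = solve-∀

    natural-inverse : ∀ n → ¬ IsZero (+ n) → Σ ℤ λ g → IsZero (g * + n - 1ℤ)
    natural-inverse n n≢0 with coprime-Bézout (coprime n n≢0)
    ... | Bézout.+- x y eq =
      + x , by (positive (+ x) (+ n) (+ y) (+ p) (lift y p x n eq)) (multiple-of-p (+ y))
    ... | Bézout.-+ x y eq =
      - + x , by (negative (+ x) (+ n) (+ y) (+ p) (lift x n y p eq)) (multiple-of-p (- + y))
  inverse -[1+ n ] n≢0 with inverse (+ suc n) (λ z → n≢0 (fromℕ∣ (toℕ∣ z)))
  ... | g , inv = - g , by (negate-both g (+ suc n)) inv
    where
    negate-both : ∀ g m → (- g) * (- m) - 1ℤ ≡ g * m - 1ℤ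
    negate-both = solve-∀

  private
    p>1 : 1 < p
    p>1 = ℕ.nonTrivial⇒n>1 p {{prime⇒nonTrivial prime}}

  one-nonzero : ¬ IsZero 1ℤ
  one-nonzero = small-nonzero 1 (s≤s z≤n) p>1

  two-nonzero : p ≢ 2 → ¬ IsZero (+ 2)
  two-nonzero p≢2 = small-nonzero 2 (s≤s z≤n) (ℕP.≤∧≢⇒< p>1 (λ eq → p≢2 (sym eq)))

  equal : ∀ a b → IsZero (b - a) → a ≡[ p ] b
  equal a b z = toℕ∣ (by (flip a b) (- 1ℤ ⊛ z))
    where
    flip : ∀ a b → a - b ≡ - 1ℤ * (b - a)
    flip = solve-∀

module Plane (p : ℕ) (prime : Prime p) where
  open GF p prime public
  open Pt public

  point : (a b c : ℤ) → (IsZero a → IsZero b → IsZero c → ⊥) → Pt p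
  point a b c nz = pt a b c (λ (za , zb , zc) → nz (vanishes za) (vanishes zb) (vanishes zc))

  not-all-zero : (A : Pt p) → IsZero (x A) → IsZero (y A) → IsZero (z A) → ⊥
  not-all-zero A zx zy zz = nonzero A (≡0 zx , ≡0 zy , ≡0 zz)

  _≐_∙_ : Pt p → ℤ → Pt p → Set
  A ≐ l ∙ B = IsZero (x A - l * x B) × IsZero (y A - l * y B) × IsZero (z A - l * z B)

  infix 4 _≃_
  record _≃_ (A B : Pt p) : Set where
    constructor proportional
    field
      factor : ℤ
      factor≢0 : ¬ IsZero factor
      multiple : A ≐ factor ∙ B

  -- the factor of a multiple of a point is automatically nonzero, as A is not the zero vector
  multiple⇒≃ : ∀ A B l → A ≐ l ∙ B → A ≃ B
  multiple⇒≃ A B l (ex , ey , ez) with zero? l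
  ... | no l≢0 = proportional l l≢0 (ex , ey , ez)
  ... | yes l≡0 =
    ⊥-elim (not-all-zero A (vanish (x A) (x B) ex) (vanish (y A) (y B) ey) (vanish (z A) (z B) ez))
    where
    split : ∀ a l b → a ≡ (a - l * b) + b * l
    split = solve-∀
    vanish : ∀ a b → IsZero (a - l * b) → IsZero a
    vanish a b e = by (split a l b) (e ⊕ b ⊛ l≡0)

  ≃⇒∼ : ∀ {A B} → A ≃ B → A ∼[ p ] B
  ≃⇒∼ (proportional l l≢0 (ex , ey , ez)) =
    l , (λ z → l≢0 (vanishes z)) , toℕ∣ ex , toℕ∣ ey , toℕ∣ ez

  ∼⇒≃ : ∀ A B → A ∼[ p ] B → A ≃ B
  ∼⇒≃ _ _ (l , l≢0 , ex , ey , ez) =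
    proportional l (λ z → l≢0 (≡0 z)) (fromℕ∣ ex , fromℕ∣ ey , fromℕ∣ ez)

  ≃-sym : ∀ {A B} → A ≃ B → B ≃ A
  ≃-sym {A} {B} (proportional l l≢0 (ex , ey , ez)) with inverse l l≢0
  ... | g , g-inv =
    multiple⇒≃ B A g (swap (x A) (x B) ex , swap (y A) (y B) ey , swap (z A) (z B) ez)
    where
    identity : ∀ a b g l → b - g * a ≡ (- b) * (g * l - 1ℤ) + (- g) * (a - l * b)
    identity = solve-∀
    swap : ∀ a b → IsZero (a - l * b) → IsZero (b - g * a)
    swap a b e = by (identity a b g l) ((- b) ⊛ g-inv ⊕ (- g) ⊛ e)

  ≃-trans : ∀ {A B C} → A ≃ B → B ≃ C → A ≃ C
  ≃-trans {A} {B} {C} (proportional l _ (ex , ey , ez)) (proportional m _ (fx , fy , fz)) =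
    multiple⇒≃ A C (l * m) (compose (x A) (x B) (x C) ex fx , compose (y A) (y B) (y C) ey fy ,
                            compose (z A) (z B) (z C) ez fz)
    where
    identity : ∀ a b c l m → a - (l * m) * c ≡ (a - l * b) + l * (b - m * c)
    identity = solve-∀
    compose : ∀ a b c → IsZero (a - l * b) → IsZero (b - m * c) → IsZero (a - (l * m) * c)
    compose a b c e f = by (identity a b c l m) (e ⊕ l ⊛ f)

  -- If b₁ ≠ 0 and the minors of (a; b) through the first column vanish, then a = (a₁/b₁) b.
  private
    pivot : (a₁ a₂ a₃ b₁ b₂ b₃ : ℤ) → ¬ IsZero b₁ →
      IsZero (a₁ * b₂ - a₂ * b₁) → IsZero (a₁ * b₃ - a₃ * b₁) →
      Σ ℤ λ l → IsZero (a₁ - l * b₁) × IsZero (a₂ - l * b₂) × IsZero (a₃ - l * b₃)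
    pivot a₁ a₂ a₃ b₁ b₂ b₃ b₁≢0 m₂ m₃ with inverse b₁ b₁≢0
    ... | g , g-inv = a₁ * g , by (first a₁ b₁ g) ((- a₁) ⊛ g-inv) ,
                               by (other a₁ a₂ b₁ b₂ g) ((- a₂) ⊛ g-inv ⊕ (- g) ⊛ m₂) ,
                               by (other a₁ a₃ b₁ b₃ g) ((- a₃) ⊛ g-inv ⊕ (- g) ⊛ m₃)
      where
      first : ∀ a₁ b₁ g → a₁ - (a₁ * g) * b₁ ≡ (- a₁) * (g * b₁ - 1ℤ)
      first = solve-∀
      other : ∀ a₁ a b₁ b g → a - (a₁ * g) * b ≡ (- a) * (g * b₁ - 1ℤ) + (- g) * (a₁ * b - a * b₁)
      other = solve-∀

    reverse : ∀ a b → IsZero (a - b) → IsZero (b - a)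
    reverse a b e = by (negation a b) (- 1ℤ ⊛ e)
      where
      negation : ∀ a b → b - a ≡ - 1ℤ * (a - b)
      negation = solve-∀

  minors-vanish⇒≃ : (A B : Pt p) →
    IsZero (y A * z B - z A * y B) → IsZero (z A * x B - x A * z B) → IsZero (x A * y B - y A * x B) →
    A ≃ B
  minors-vanish⇒≃ A B m₁ m₂ m₃ = by-pivot (zero? (x B)) (zero? (y B)) (zero? (z B))
    where
    by-pivot : Dec (IsZero (x B)) → Dec (IsZero (y B)) → Dec (IsZero (z B)) → A ≃ B
    by-pivot (no bx≢0) _ _ =
      let (l , ex , ey , ez) = pivot (x A) (y A) (z A) (x B) (y B) (z B) bx≢0
                                     m₃ (reverse (z A * x B) (x A * z B) m₂)
      in multiple⇒≃ A B l (ex , ey , ez)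
    by-pivot (yes _) (no by≢0) _ =
      let (l , ey , ex , ez) = pivot (y A) (x A) (z A) (y B) (x B) (z B) by≢0
                                     (reverse (x A * y B) (y A * x B) m₃) m₁
      in multiple⇒≃ A B l (ex , ey , ez)
    by-pivot (yes _) (yes _) (no bz≢0) =
      let (l , ez , ex , ey) = pivot (z A) (x A) (y A) (z B) (x B) (y B) bz≢0
                                     m₂ (reverse (y A * z B) (z A * y B) m₁)
      in multiple⇒≃ A B l (ex , ey , ez)
    by-pivot (yes bx) (yes by) (yes bz) = ⊥-elim (not-all-zero B bx by bz)

  dot : Pt p → Pt p → ℤ
  dot L P = x L * x P + y L * y P + z L * z P

  incident : ∀ L P → Inc P L → IsZero (dot L P)
  incident L P P∈L = vanishes P∈L

  cross : (U U' : Pt p) → ¬ U ≃ U' → Pt p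
  cross U U' U≄U' =
    point (y U * z U' - z U * y U') (z U * x U' - x U * z U') (x U * y U' - y U * x U')
          (λ m₁ m₂ m₃ → U≄U' (minors-vanish⇒≃ U U' m₁ m₂ m₃))

  orthogonal⇒≃cross : (U U' V : Pt p) (U≄U' : ¬ U ≃ U') →
    IsZero (dot V U) → IsZero (dot V U') → V ≃ cross U U' U≄U'
  orthogonal⇒≃cross U U' V U≄U' VU VU' = minors-vanish⇒≃ V (cross U U' U≄U')
    (by (first (x V) (y V) (z V) (x U) (y U) (z U) (x U') (y U') (z U')) (x U ⊛ VU' ⊕ (- x U') ⊛ VU))
    (by (second (x V) (y V) (z V) (x U) (y U) (z U) (x U') (y U') (z U')) (y U ⊛ VU' ⊕ (- y U') ⊛ VU))
    (by (third (x V) (y V) (z V) (x U) (y U) (z U) (x U') (y U') (z U')) (z U ⊛ VU' ⊕ (- z U') ⊛ VU))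
    where
    first : ∀ v₁ v₂ v₃ u₁ u₂ u₃ w₁ w₂ w₃ →
      v₂ * (u₁ * w₂ - u₂ * w₁) - v₃ * (u₃ * w₁ - u₁ * w₃)
        ≡ u₁ * (v₁ * w₁ + v₂ * w₂ + v₃ * w₃) + (- w₁) * (v₁ * u₁ + v₂ * u₂ + v₃ * u₃)
    first = solve-∀
    second : ∀ v₁ v₂ v₃ u₁ u₂ u₃ w₁ w₂ w₃ →
      v₃ * (u₂ * w₃ - u₃ * w₂) - v₁ * (u₁ * w₂ - u₂ * w₁)
        ≡ u₂ * (v₁ * w₁ + v₂ * w₂ + v₃ * w₃) + (- w₂) * (v₁ * u₁ + v₂ * u₂ + v₃ * u₃)
    second = solve-∀
    third : ∀ v₁ v₂ v₃ u₁ u₂ u₃ w₁ w₂ w₃ →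
      v₁ * (u₃ * w₁ - u₁ * w₃) - v₂ * (u₂ * w₃ - u₃ * w₂)
        ≡ u₃ * (v₁ * w₁ + v₂ * w₂ + v₃ * w₃) + (- w₃) * (v₁ * u₁ + v₂ * u₂ + v₃ * u₃)
    third = solve-∀

  orthogonal-unique : (U U' V V' : Pt p) → ¬ U ≃ U' →
    IsZero (dot V U) → IsZero (dot V U') → IsZero (dot V' U) → IsZero (dot V' U') → V ≃ V'
  orthogonal-unique U U' V V' U≄U' VU VU' V'U V'U' =
    ≃-trans (orthogonal⇒≃cross U U' V U≄U' VU VU') (≃-sym (orthogonal⇒≃cross U U' V' U≄U' V'U V'U'))

  record Weights : Set where
    constructor weights
    field
      w₁ w₂ w₃ : ℤ
      w₁≢0 : ¬ IsZero w₁
      w₂≢0 : ¬ IsZero w₂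
      w₃≢0 : ¬ IsZero w₃

  infixr 8 _⊙_
  _⊙_ : Weights → Pt p → Pt p
  weights w₁ w₂ w₃ w₁≢0 w₂≢0 w₃≢0 ⊙ V =
    point (w₁ * x V) (w₂ * y V) (w₃ * z V)
          (λ z₁ z₂ z₃ → not-all-zero V (cancel w₁≢0 z₁) (cancel w₂≢0 z₂) (cancel w₃≢0 z₃))

  ⊙-cancel : (w : Weights) (V V' : Pt p) → w ⊙ V ≃ w ⊙ V' → V ≃ V'
  ⊙-cancel (weights w₁ w₂ w₃ w₁≢0 w₂≢0 w₃≢0) V V' (proportional l l≢0 (ex , ey , ez)) =
    proportional l l≢0 (unscale w₁≢0 (x V) (x V') ex , unscale w₂≢0 (y V) (y V') ey ,
                        unscale w₃≢0 (z V) (z V') ez)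
    where
    distribute : ∀ m a l b → m * a - l * (m * b) ≡ m * (a - l * b)
    distribute = solve-∀
    unscale : ∀ {m} → ¬ IsZero m → ∀ a b → IsZero (m * a - l * (m * b)) → IsZero (a - l * b)
    unscale {m} m≢0 a b e = cancel m≢0 (by (sym (distribute m a l b)) e)

  another-point : (L B : Pt p) → Inc B L → Σ (Pt p) λ Y → Inc Y L × ¬ Y ≃ B
  another-point L B B∈L = choose (zero? (x B)) (zero? (y B)) (zero? (z B))
    where
    unnegate : ∀ a → a ≡ - 1ℤ * (- a)
    unnegate = solve-∀
    negate : ∀ a → a ≡ - 1ℤ * (0ℤ - a)
    negate = solve-∀
    -- take Y on L with a zero coordinate where B has a nonzero one
    choose : Dec (IsZero (x B)) → Dec (IsZero (y B)) → Dec (IsZero (z B)) →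
             Σ (Pt p) λ Y → Inc Y L × ¬ Y ≃ B
    choose (no bx≢0) _ _ =
      point 0ℤ (z L) (- y L) nonzero-Y , ≡0 (by (on-L (x L) (y L) (z L)) zero-0) , different
      where
      on-L : ∀ l₁ l₂ l₃ → l₁ * 0ℤ + l₂ * l₃ + l₃ * (- l₂) ≡ 0ℤ
      on-L = solve-∀
      isolate : ∀ l₁ l₂ l₃ b₁ b₂ b₃ →
        b₁ * l₁ ≡ l₁ * b₁ + l₂ * b₂ + l₃ * b₃ + ((- b₂) * l₂ + (- b₃) * l₃)
      isolate = solve-∀
      nonzero-Y : IsZero 0ℤ → IsZero (z L) → IsZero (- y L) → ⊥
      nonzero-Y _ lz -ly = not-all-zero L lx ly lz
        where
        ly = by (unnegate (y L)) (- 1ℤ ⊛ -ly)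
        lx = cancel bx≢0 (by (isolate (x L) (y L) (z L) (x B) (y B) (z B))
                             (incident L B B∈L ⊕ (- y B) ⊛ ly ⊕ (- z B) ⊛ lz))
      different : ¬ point 0ℤ (z L) (- y L) nonzero-Y ≃ B
      different (proportional m m≢0 (ex , _ , _)) =
        nonzero-* m≢0 bx≢0 (by (negate (m * x B)) (- 1ℤ ⊛ ex))
    choose (yes _) (no by≢0) _ =
      point (- z L) 0ℤ (x L) nonzero-Y , ≡0 (by (on-L (x L) (y L) (z L)) zero-0) , different
      where
      on-L : ∀ l₁ l₂ l₃ → l₁ * (- l₃) + l₂ * 0ℤ + l₃ * l₁ ≡ 0ℤ
      on-L = solve-∀
      isolate : ∀ l₁ l₂ l₃ b₁ b₂ b₃ →
        b₂ * l₂ ≡ l₁ * b₁ + l₂ * b₂ + l₃ * b₃ + ((- b₁) * l₁ + (- b₃) * l₃)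
      isolate = solve-∀
      nonzero-Y : IsZero (- z L) → IsZero 0ℤ → IsZero (x L) → ⊥
      nonzero-Y -lz _ lx = not-all-zero L lx ly lz
        where
        lz = by (unnegate (z L)) (- 1ℤ ⊛ -lz)
        ly = cancel by≢0 (by (isolate (x L) (y L) (z L) (x B) (y B) (z B))
                             (incident L B B∈L ⊕ (- x B) ⊛ lx ⊕ (- z B) ⊛ lz))
      different : ¬ point (- z L) 0ℤ (x L) nonzero-Y ≃ B
      different (proportional m m≢0 (_ , ey , _)) =
        nonzero-* m≢0 by≢0 (by (negate (m * y B)) (- 1ℤ ⊛ ey))
    choose (yes _) (yes _) (no bz≢0) =
      point (y L) (- x L) 0ℤ nonzero-Y , ≡0 (by (on-L (x L) (y L) (z L)) zero-0) , different
      where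
      on-L : ∀ l₁ l₂ l₃ → l₁ * l₂ + l₂ * (- l₁) + l₃ * 0ℤ ≡ 0ℤ
      on-L = solve-∀
      isolate : ∀ l₁ l₂ l₃ b₁ b₂ b₃ →
        b₃ * l₃ ≡ l₁ * b₁ + l₂ * b₂ + l₃ * b₃ + ((- b₁) * l₁ + (- b₂) * l₂)
      isolate = solve-∀
      nonzero-Y : IsZero (y L) → IsZero (- x L) → IsZero 0ℤ → ⊥
      nonzero-Y ly -lx _ = not-all-zero L lx ly lz
        where
        lx = by (unnegate (x L)) (- 1ℤ ⊛ -lx)
        lz = cancel bz≢0 (by (isolate (x L) (y L) (z L) (x B) (y B) (z B))
                             (incident L B B∈L ⊕ (- x B) ⊛ lx ⊕ (- y B) ⊛ ly))
      different : ¬ point (y L) (- x L) 0ℤ nonzero-Y ≃ B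
      different (proportional m m≢0 (_ , _ , ez)) =
        nonzero-* m≢0 bz≢0 (by (negate (m * z B)) (- 1ℤ ⊛ ez))
    choose (yes bx) (yes by) (yes bz) = ⊥-elim (not-all-zero B bx by bz)

module Conics (p : ℕ) (prime : Prime p) (p≢2 : p ≢ 2) (c : ℤ) (c≢0 : ¬ c ≡[ p ] 0ℤ) where
  open Plane p prime public

  c-nonzero : ¬ IsZero c
  c-nonzero c≡0 = c≢0 (≡0 c≡0)

  Φ : ℕ → Pt p → Pt p → ℤ
  Φ k U V = x U * x V + + k * (y U * y V) + c * + k * (z U * z V)

  on-conic : ∀ k P → Conic p c k P → IsZero (Φ k P P)
  on-conic k P P∈O = vanishes P∈O

  conic-weights : (k : ℕ) → ¬ IsZero (+ k) → Weights
  conic-weights k k≢0 = weights 1ℤ (+ k) (c * + k) one-nonzero k≢0 (nonzero-* c-nonzero k≢0)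

  polar-dot : ∀ k k≢0 U V → dot (conic-weights k k≢0 ⊙ U) V ≡ Φ k U V
  polar-dot k _ U V = identity (+ k) c (x U) (y U) (z U) (x V) (y V) (z V)
    where
    identity : ∀ K c u₁ u₂ u₃ v₁ v₂ v₃ →
      1ℤ * u₁ * v₁ + K * u₂ * v₂ + c * K * u₃ * v₃ ≡ u₁ * v₁ + K * (u₂ * v₂) + c * K * (u₃ * v₃)
    identity = solve-∀

  Φ-sym : ∀ k U V → IsZero (Φ k U V) → IsZero (Φ k V U)
  Φ-sym k U V = by (symmetric (+ k) c (x U) (y U) (z U) (x V) (y V) (z V))
    where
    symmetric : ∀ K c u₁ u₂ u₃ v₁ v₂ v₃ →
      v₁ * u₁ + K * (v₂ * u₂) + c * K * (v₃ * u₃) ≡ u₁ * v₁ + K * (u₂ * v₂) + c * K * (u₃ * v₃)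
    symmetric = solve-∀

  Φ-linear : ∀ k V V' l U → V ≐ l ∙ V' → IsZero (Φ k V' U) → IsZero (Φ k V U)
  Φ-linear k V V' l U (ex , ey , ez) V'U =
    by (expand (+ k) c l (x V) (y V) (z V) (x V') (y V') (z V') (x U) (y U) (z U))
       (l ⊛ V'U ⊕ x U ⊛ ex ⊕ (+ k * y U) ⊛ ey ⊕ (c * + k * z U) ⊛ ez)
    where
    expand : ∀ K c l v₁ v₂ v₃ w₁ w₂ w₃ u₁ u₂ u₃ →
      v₁ * u₁ + K * (v₂ * u₂) + c * K * (v₃ * u₃)
        ≡ l * (w₁ * u₁ + K * (w₂ * u₂) + c * K * (w₃ * u₃))
          + (u₁ * (v₁ - l * w₁) + (K * u₂ * (v₂ - l * w₂) + c * K * u₃ * (v₃ - l * w₃)))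
    expand = solve-∀

  on-conic-resp : ∀ k {A B} → A ≃ B → Conic p c k B → Conic p c k A
  on-conic-resp k {A} {B} (proportional l _ e) B∈O =
    ≡0 (Φ-linear k A B l A e (Φ-sym k A B (Φ-linear k A B l B e (on-conic k B B∈O))))

  Touches : ℕ → Line p → Pt p → Set
  Touches k L T = Conic p c k T × Inc T L × (∀ Q → Conic p c k Q → Inc Q L → Q ∼[ p ] T)

  -- The line TB meets O_k again in V = Φ(B,B) T - 2 Φ(T,B) B, which lies on L and hence is
  -- a multiple l T of T; so (Φ(B,B) - l) T = 2 Φ(T,B) B, impossible for Φ(T,B) ≠ 0 as B ≄ T.
  contact-conjugate : ∀ k L T → Touches k L T → ∀ B → Inc B L → ¬ B ≃ T → IsZero (Φ k T B)
  contact-conjugate k L T (T∈O , T∈L , only-T) B B∈L B≄T = decide (zero? (Φ k T B))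
    where
    f h v₁ v₂ v₃ : ℤ
    f = Φ k B B
    h = + 2 * Φ k T B
    v₁ = f * x T - h * x B
    v₂ = f * y T - h * y B
    v₃ = f * z T - h * z B

    second : ¬ (IsZero v₁ × IsZero v₂ × IsZero v₃) → Pt p
    second V≢0 = point v₁ v₂ v₃ (λ z₁ z₂ z₃ → V≢0 (z₁ , z₂ , z₃))

    second-on-conic : ∀ V≢0 → Conic p c k (second V≢0)
    second-on-conic _ =
      ≡0 (by (reflected (+ k) c (x T) (y T) (z T) (x B) (y B) (z B)) ((f * f) ⊛ on-conic k T T∈O))
      where
      reflected : ∀ K c t₁ t₂ t₃ b₁ b₂ b₃ →
        let f = b₁ * b₁ + K * (b₂ * b₂) + c * K * (b₃ * b₃)
            h = + 2 * (t₁ * b₁ + K * (t₂ * b₂) + c * K * (t₃ * b₃))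
            v₁ = f * t₁ - h * b₁
            v₂ = f * t₂ - h * b₂
            v₃ = f * t₃ - h * b₃
        in v₁ * v₁ + K * (v₂ * v₂) + c * K * (v₃ * v₃)
             ≡ (f * f) * (t₁ * t₁ + K * (t₂ * t₂) + c * K * (t₃ * t₃))
      reflected = solve-∀

    second-on-L : ∀ V≢0 → Inc (second V≢0) L
    second-on-L _ =
      ≡0 (by (combination f h (x L) (y L) (z L) (x T) (y T) (z T) (x B) (y B) (z B))
             (f ⊛ incident L T T∈L ⊕ (- h) ⊛ incident L B B∈L))
      where
      combination : ∀ f h l₁ l₂ l₃ t₁ t₂ t₃ b₁ b₂ b₃ →
        l₁ * (f * t₁ - h * b₁) + l₂ * (f * t₂ - h * b₂) + l₃ * (f * t₃ - h * b₃)
          ≡ f * (l₁ * t₁ + l₂ * t₂ + l₃ * t₃) + (- h) * (l₁ * b₁ + l₂ * b₂ + l₃ * b₃)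
      combination = solve-∀

    -- V is a multiple of T (trivially so when V is the zero vector)
    second-multiple : Σ ℤ λ l → IsZero (v₁ - l * x T) × IsZero (v₂ - l * y T) × IsZero (v₃ - l * z T)
    second-multiple = from (zero? v₁ ×-dec zero? v₂ ×-dec zero? v₃)
      where
      drop : ∀ v t → v - 0ℤ * t ≡ v
      drop = solve-∀
      from : Dec (IsZero v₁ × IsZero v₂ × IsZero v₃) →
             Σ ℤ λ l → IsZero (v₁ - l * x T) × IsZero (v₂ - l * y T) × IsZero (v₃ - l * z T)
      from (yes (z₁ , z₂ , z₃)) =
        0ℤ , by (drop v₁ (x T)) z₁ , by (drop v₂ (y T)) z₂ , by (drop v₃ (z T)) z₃
      from (no V≢0) =
        let proportional l _ e = ∼⇒≃ (second V≢0) T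
                                   (only-T (second V≢0) (second-on-conic V≢0) (second-on-L V≢0))
        in l , e

    decide : Dec (IsZero (Φ k T B)) → IsZero (Φ k T B)
    decide (yes conjugate) = conjugate
    decide (no ¬conjugate) =
      let g , g-inv = inverse h (nonzero-* (two-nonzero p≢2) ¬conjugate)
          l , ex , ey , ez = second-multiple
          solve : ∀ b t → IsZero (f * t - h * b - l * t) → IsZero (b - (g * (f - l)) * t)
          solve b t e = by (isolate b t g h f l) ((- b) ⊛ g-inv ⊕ (- g) ⊛ e)
      in ⊥-elim (B≄T (multiple⇒≃ B T (g * (f - l)) (solve (x B) (x T) ex , solve (y B) (y T) ey ,
                                                       solve (z B) (z T) ez)))
      where
      isolate : ∀ b t g h f l →
        b - (g * (f - l)) * t ≡ (- b) * (g * h - 1ℤ) + (- g) * ((f * t - h * b) - l * t)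
      isolate = solve-∀

  -- The only tangent of O_k through a point B of O_k is its polar line diag(1,k,ck) B:
  -- B is then the point of contact, and the tangent and the polar both join B to any
  -- further point Y of the tangent, Y being conjugate to B by polarity.
  tangent-is-polar : ∀ k (k≢0 : ¬ IsZero (+ k)) B → Conic p c k B →
    ∀ L → IsTangent (Conic p c k) L → Inc B L → L ≃ conic-weights k k≢0 ⊙ B
  tangent-is-polar k k≢0 B B∈O L (T , touch@(_ , _ , only-T)) B∈L =
    let Y , Y∈L , Y≄B = another-point L B B∈L
        B≃T = ∼⇒≃ B T (only-T B B∈O B∈L)
        proportional l _ B≐T = B≃T
        TY = contact-conjugate k L T touch Y Y∈L (λ Y≃T → Y≄B (≃-trans Y≃T (≃-sym B≃T)))
        BY = Φ-linear k B T l Y B≐T TY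
    in orthogonal-unique B Y L (conic-weights k k≢0 ⊙ B) (λ B≃Y → Y≄B (≃-sym B≃Y))
         (incident L B B∈L) (incident L Y Y∈L)
         (by (polar-dot k k≢0 B B) (on-conic k B B∈O)) (by (polar-dot k k≢0 B Y) BY)

  -- Exactly one tangent passes through a point of a conic, so it is not an exterior point.
  conic-point-not-exterior : ∀ k → ¬ IsZero (+ k) → ∀ B → Conic p c k B →
    ¬ IsExterior (Conic p c k) B
  conic-point-not-exterior k k≢0 B B∈O (L₁ , L₂ , tangent₁ , B∈L₁ , tangent₂ , B∈L₂ , L₁≄L₂ , _) =
    L₁≄L₂ (≃⇒∼ (≃-trans (tangent-is-polar k k≢0 B B∈O L₁ tangent₁ B∈L₁)
                        (≃-sym (tangent-is-polar k k≢0 B B∈O L₂ tangent₂ B∈L₂))))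

  -- Distinct points of O_k are never conjugate: otherwise their polar lines would both
  -- be the line joining them, and polarity is invertible.
  distinct-not-conjugate : ∀ k → ¬ IsZero (+ k) → ∀ B B' → Conic p c k B → Conic p c k B' →
    ¬ B ≃ B' → ¬ IsZero (Φ k B B')
  distinct-not-conjugate k k≢0 B B' B∈O B'∈O B≄B' BB' =
    B≄B' (⊙-cancel w B B' (orthogonal-unique B B' (w ⊙ B) (w ⊙ B') B≄B'
      (by (polar-dot k k≢0 B B) (on-conic k B B∈O)) (by (polar-dot k k≢0 B B') BB')
      (by (polar-dot k k≢0 B' B) (Φ-sym k B B' BB')) (by (polar-dot k k≢0 B' B') (on-conic k B' B'∈O))))
    where
    w : Weights
    w = conic-weights k k≢0

  -- The point of contact T is conjugate to B and B',
  -- so T is the pole W = adj(diag(1,k,ck)) (B × B') of the line BB', and Φ(W,W) is k²c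
  -- times the Gram determinant (Lagrange's identity).
  tangent-chord : ∀ k → ¬ IsZero (+ k) → ∀ L → IsTangent (Conic p c k) L →
    ∀ B B' → Inc B L → Inc B' L → ¬ B ≃ B' → ¬ Conic p c k B → ¬ Conic p c k B' →
    IsZero (Φ k B B * Φ k B' B' - Φ k B B' * Φ k B B')
  tangent-chord k k≢0 L (T , touch@(T∈O , _ , _)) B B' B∈L B'∈L B≄B' B∉O B'∉O =
    cancel (nonzero-* (nonzero-* k≢0 k≢0) c-nonzero)
      (by (lagrange K c (x B) (y B) (z B) (x B') (y B') (z B')) (on-conic k W W∈O))
    where
    K : ℤ
    K = + k
    w : Weights
    w = conic-weights k k≢0
    cK≢0 : ¬ IsZero (c * K)
    cK≢0 = nonzero-* c-nonzero k≢0

    W : Pt p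
    W = point (K * (c * K) * (y B * z B' - z B * y B')) (c * K * (z B * x B' - x B * z B'))
              (K * (x B * y B' - y B * x B'))
              (λ z₁ z₂ z₃ → B≄B' (minors-vanish⇒≃ B B' (cancel (nonzero-* k≢0 cK≢0) z₁)
                                                       (cancel cK≢0 z₂) (cancel k≢0 z₃)))

    pole-orthogonal : ∀ K c b₁ b₂ b₃ d₁ d₂ d₃ →
      1ℤ * (K * (c * K) * (b₂ * d₃ - b₃ * d₂)) * b₁ + K * (c * K * (b₃ * d₁ - b₁ * d₃)) * b₂
        + c * K * (K * (b₁ * d₂ - b₂ * d₁)) * b₃ ≡ 0ℤ
    pole-orthogonal = solve-∀
    pole-orthogonal' : ∀ K c b₁ b₂ b₃ d₁ d₂ d₃ →
      1ℤ * (K * (c * K) * (b₂ * d₃ - b₃ * d₂)) * d₁ + K * (c * K * (b₃ * d₁ - b₁ * d₃)) * d₂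
        + c * K * (K * (b₁ * d₂ - b₂ * d₁)) * d₃ ≡ 0ℤ
    pole-orthogonal' = solve-∀

    off-conic⇒≄T : ∀ P → ¬ Conic p c k P → ¬ P ≃ T
    off-conic⇒≄T P P∉O P≃T = P∉O (on-conic-resp k P≃T T∈O)

    T≃W : T ≃ W
    T≃W = ⊙-cancel w T W (orthogonal-unique B B' (w ⊙ T) (w ⊙ W) B≄B'
      (by (polar-dot k k≢0 T B) (contact-conjugate k L T touch B B∈L (off-conic⇒≄T B B∉O)))
      (by (polar-dot k k≢0 T B') (contact-conjugate k L T touch B' B'∈L (off-conic⇒≄T B' B'∉O)))
      (by (pole-orthogonal K c (x B) (y B) (z B) (x B') (y B') (z B')) zero-0)
      (by (pole-orthogonal' K c (x B) (y B) (z B) (x B') (y B') (z B')) zero-0))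

    W∈O : Conic p c k W
    W∈O = on-conic-resp k (≃-sym T≃W) T∈O

    lagrange : ∀ K c b₁ b₂ b₃ d₁ d₂ d₃ →
      let Φbb = b₁ * b₁ + K * (b₂ * b₂) + c * K * (b₃ * b₃)
          Φdd = d₁ * d₁ + K * (d₂ * d₂) + c * K * (d₃ * d₃)
          Φbd = b₁ * d₁ + K * (b₂ * d₂) + c * K * (b₃ * d₃)
          w₁ = K * (c * K) * (b₂ * d₃ - b₃ * d₂)
          w₂ = c * K * (b₃ * d₁ - b₁ * d₃)
          w₃ = K * (b₁ * d₂ - b₂ * d₁)
      in K * K * c * (Φbb * Φdd - Φbd * Φbd) ≡ w₁ * w₁ + K * (w₂ * w₂) + c * K * (w₃ * w₃)
    lagrange = solve-∀

  -- The form ρ = diag(2β - α, αβ, cαβ) on which the sides of a Poncelet polygon vanish.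
  ρ : ℕ → ℕ → Pt p → Pt p → ℤ
  ρ α β B B' = (+ 2 * + β - + α) * x B * x B' + + α * + β * y B * y B' + c * (+ α * + β) * z B * z B'

  ρ-weights : ∀ α β → ¬ IsZero (+ 2 * + β - + α) → ¬ IsZero (+ α) → ¬ IsZero (+ β) → Weights
  ρ-weights α β d≢0 α≢0 β≢0 =
    weights (+ 2 * + β - + α) (+ α * + β) (c * (+ α * + β)) d≢0 αβ≢0 (nonzero-* c-nonzero αβ≢0)
    where
    αβ≢0 : ¬ IsZero (+ α * + β)
    αβ≢0 = nonzero-* α≢0 β≢0

  -- For B, B' on O_β, β² times the Gram determinant of B, B' for Φ_α is the product
  -- F₋ F₊ of the two chord factors F± = (β - α) x x' ± β Φ_α(B,B').
  -- chord-factor s with s = -1, 1 is F₋, F₊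
  chord-factor : ℤ → ℕ → ℕ → Pt p → Pt p → ℤ
  chord-factor s α β B B' = (+ β - + α) * (x B * x B') + s * (+ β * Φ α B B')

  chord-factors : ∀ α β B B' → Conic p c β B → Conic p c β B' →
    IsZero (Φ α B B * Φ α B' B' - Φ α B B' * Φ α B B') →
    IsZero (chord-factor (- 1ℤ) α β B B') ⊎ IsZero (chord-factor 1ℤ α β B B')
  chord-factors α β B B' B∈Oβ B'∈Oβ gram =
    zero-product (chord-factor (- 1ℤ) α β B B') (chord-factor 1ℤ α β B B')
      (by (factorise (+ α) (+ β) c (x B) (y B) (z B) (x B') (y B') (z B'))
      ((+ β * + β) ⊛ gram
       ⊕ (- (+ α * (+ β - + α) * (x B' * x B'))) ⊛ on-conic β B B∈Oβ
       ⊕ (- (+ α * + β * Φ α B B)) ⊛ on-conic β B' B'∈Oβ))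
    where
    factorise : ∀ a b c b₁ b₂ b₃ d₁ d₂ d₃ →
      let Φbb = b₁ * b₁ + a * (b₂ * b₂) + c * a * (b₃ * b₃)
          Φdd = d₁ * d₁ + a * (d₂ * d₂) + c * a * (d₃ * d₃)
          Φbd = b₁ * d₁ + a * (b₂ * d₂) + c * a * (b₃ * d₃)
          Ψbb = b₁ * b₁ + b * (b₂ * b₂) + c * b * (b₃ * b₃)
          Ψdd = d₁ * d₁ + b * (d₂ * d₂) + c * b * (d₃ * d₃)
      in ((b - a) * (b₁ * d₁) + - 1ℤ * (b * Φbd)) * ((b - a) * (b₁ * d₁) + 1ℤ * (b * Φbd))
           ≡ (b * b) * (Φbb * Φdd - Φbd * Φbd)
             + ((- (a * (b - a) * (d₁ * d₁))) * Ψbb + (- (a * b * Φbb)) * Ψdd)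
    factorise = solve-∀

  minus-factor : ∀ α β B B' → ¬ IsZero (+ α) →
    IsZero (chord-factor (- 1ℤ) α β B B') → IsZero (Φ β B B')
  minus-factor α β B B' α≢0 F₋≡0 =
    cancel α≢0 (by (identity (+ α) (+ β) c (x B) (y B) (z B) (x B') (y B') (z B')) (- 1ℤ ⊛ F₋≡0))
    where
    identity : ∀ a b c b₁ b₂ b₃ d₁ d₂ d₃ →
      a * (b₁ * d₁ + b * (b₂ * d₂) + c * b * (b₃ * d₃))
        ≡ - 1ℤ * ((b - a) * (b₁ * d₁) + - 1ℤ * (b * (b₁ * d₁ + a * (b₂ * d₂) + c * a * (b₃ * d₃))))
    identity = solve-∀

  plus-factor : ∀ α β B B' → IsZero (chord-factor 1ℤ α β B B') → IsZero (ρ α β B B')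
  plus-factor α β B B' = by (identity (+ α) (+ β) c (x B) (y B) (z B) (x B') (y B') (z B'))
    where
    identity : ∀ a b c b₁ b₂ b₃ d₁ d₂ d₃ →
      (+ 2 * b - a) * b₁ * d₁ + a * b * b₂ * d₂ + c * (a * b) * b₃ * d₃
        ≡ (b - a) * (b₁ * d₁) + 1ℤ * (b * (b₁ * d₁ + a * (b₂ * d₂) + c * a * (b₃ * d₃)))
    identity = solve-∀

  -- A side of a Poncelet polygon for (O_α, O_β): distinct points B, B' of O_β, off O_α,
  -- spanning a tangent of O_α, satisfy ρ(B,B') = 0, as the factor F₋ cannot vanish.
  side-relation : ∀ α β → ¬ IsZero (+ α) → ¬ IsZero (+ β) →
    ∀ L → IsTangent (Conic p c α) L → ∀ B B' → Inc B L → Inc B' L → ¬ B ≃ B' →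
    Conic p c β B → Conic p c β B' → ¬ Conic p c α B → ¬ Conic p c α B' → IsZero (ρ α β B B')
  side-relation α β α≢0 β≢0 L tangent B B' B∈L B'∈L B≄B' B∈Oβ B'∈Oβ B∉Oα B'∉Oα =
    [ (λ F₋≡0 → ⊥-elim (distinct-not-conjugate β β≢0 B B' B∈Oβ B'∈Oβ B≄B'
                           (minus-factor α β B B' α≢0 F₋≡0)))
    , plus-factor α β B B'
    ]′ (chord-factors α β B B' B∈Oβ B'∈Oβ
          (tangent-chord α α≢0 L tangent B B' B∈L B'∈L B≄B' B∉Oα B'∉Oα))

-- Theorem 15.  Every vertex of a Poncelet quadrilateral B₀B₁B₂B₃ for (O_α, O_β) is exterior
-- to O_α, hence off O_α, so its four sides give ρ(B₁,B₀) = ρ(B₁,B₂) = ρ(B₃,B₂) = ρ(B₃,B₀) = 0.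
-- If 2β - α ≠ 0 then ρ is nondegenerate, and ρ(B₁,·), ρ(B₃,·) both vanish at the distinct
-- points B₀, B₂, forcing B₁ = B₃.  Hence α = 2β.
mainTheorem15 : (p : ℕ) → Prime p → p ≢ 2 →
    (c : ℤ) → ¬ (c ≡[ p ] 0ℤ) →
    (p % 4 ≡ 1 → ¬ IsSquare p c) →
    (p % 4 ≡ 3 → IsSquare p c) →
    (α β : ℕ) → 1 ≤ α → α < p → 1 ≤ β → β < p →
    Conic p c α ◇ Conic p c β →
    PonceletPolygon 4 (Conic p c α) (Conic p c β) →
    (+ α) ≡[ p ] ((+ 2) * (+ β))
mainTheorem15 p p-prime p≢2 c c≢0 _ _ α β 1≤α α<p 1≤β β<p Oα◇Oβ (B , distinct , on-β , sides) =
  equal (+ α) (+ 2 * + β) (decidable-stable (zero? (+ 2 * + β - + α)) not-α≢2β)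
  where
  open Conics p p-prime p≢2 c c≢0

  α≢0 : ¬ IsZero (+ α)
  α≢0 = small-nonzero α 1≤α α<p
  β≢0 : ¬ IsZero (+ β)
  β≢0 = small-nonzero β 1≤β β<p

  -- the vertices, being exterior to O_α, lie off O_α
  off-α : ∀ i → ¬ Conic p c α (B i)
  off-α i Bi∈Oα = conic-point-not-exterior α α≢0 (B i) Bi∈Oα (Oα◇Oβ (B i) (on-β i))

  side : ∀ i j → i ≢ j → ∀ L → IsTangent (Conic p c α) L → Inc (B i) L → Inc (B j) L →
    IsZero (ρ α β (B i) (B j))
  side i j i≢j L tangent Bi∈L Bj∈L = side-relation α β α≢0 β≢0 L tangent (B i) (B j) Bi∈L Bj∈L
    (λ Bi≃Bj → distinct i j i≢j (≃⇒∼ Bi≃Bj)) (on-β i) (on-β j) (off-α i) (off-α j)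

  not-α≢2β : ¬ ¬ IsZero (+ 2 * + β - + α)
  not-α≢2β α≢2β =
    let L₀ , t₀ , B₀∈L₀ , B₁∈L₀ = sides (# 0)
        L₁ , t₁ , B₁∈L₁ , B₂∈L₁ = sides (# 1)
        L₂ , t₂ , B₂∈L₂ , B₃∈L₂ = sides (# 2)
        L₃ , t₃ , B₃∈L₃ , B₀∈L₃ = sides (# 3)
        R = ρ-weights α β α≢2β α≢0 β≢0
    in distinct (# 1) (# 3) (λ ()) (≃⇒∼ (⊙-cancel R (B (# 1)) (B (# 3))
         (orthogonal-unique (B (# 0)) (B (# 2)) (R ⊙ B (# 1)) (R ⊙ B (# 3))
           (λ B₀≃B₂ → distinct (# 0) (# 2) (λ ()) (≃⇒∼ B₀≃B₂))
           (side (# 1) (# 0) (λ ()) L₀ t₀ B₁∈L₀ B₀∈L₀) (side (# 1) (# 2) (λ ()) L₁ t₁ B₁∈L₁ B₂∈L₁)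
           (side (# 3) (# 0) (λ ()) L₃ t₃ B₃∈L₃ B₀∈L₃) (side (# 3) (# 2) (λ ()) L₂ t₂ B₃∈L₂ B₂∈L₂))))
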